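{- Let $G=(V,E)$ be a connected graph which is $P_8$-free, $K_4$-free, diamond-free and butterfly-free, and let $M$ be a dominating induced matching of $G$ with $|M|\ge 2$. Let $xy\in M$ and let $r$ be a vertex with $rx\in E$, $ry\notin E$. For $i\ge 1$ let $N_i=\{z\in V: \mathrm{dist}_G(z,\{x,y\})=i\}$. Assume that $N_2$ is an independent set, and write $N_2=\{u_1,\dots,u_k\}$; for each $i$ let $u_i'$ denote the vertex with $u_iu_i'\in M$ (so $u_i'\in N_3$). Let $T_{one}=\{t\in N_3: |N(t)\cap N_2|=1\}$, $T_i=T_{one}\cap N(u_i)$ for $i\in\{1,\dots,k\}$, and $S_3=N_3\setminus T_{one}$. Let $V(M)$ be the set of vertices covered by $M$ and $I=V\setminus V(M)$. Then: (i) for all $i$, $T_i\cap V(M)=\{u_i'\}$; (ii) for all $i$, $G[T_i]$ is the disjoint union of isolated vertices and at most one edge; (iii) $G[N_3]$ is bipartite; (iv) $S_3\subseteq I$; in particular $S_3$ is an independent set; (v) if for some $i\ne j$ a vertex $t_i\in T_i$ is adjacent to two vertices of $T_j$, then $t_i=u_i'$, i.e., $u_it_i\in M$.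
   Context: Graphs are finite, simple, undirected. $P_8$ is the chordless path on 8 vertices; $K_4$ the complete graph on 4 vertices; the diamond is $K_4$ minus an edge; the butterfly is the graph with vertices $a,b,c,d,e$ and edges $ab,ac,bc,cd,ce,de$. A graph is $H$-free if it has no induced copy of $H$. A dominating induced matching (d.i.m.) is a set $M\subseteq E$ such that every edge of $G$ shares a vertex with exactly one edge of $M$. The distance from a vertex $z$ to the edge $xy$ is $\min\{\mathrm{dist}_G(z,x),\mathrm{dist}_G(z,y)\}$. -}

module Defs where

open import Data.Nat using (ℕ; zero; suc; _<_)
open import Data.Fin using (Fin; #_)
open import Data.Bool using (Bool)
open import Data.List using (List; _∷_; [])
open import Data.List.Membership.Propositional using (_∈_)
open import Data.Product using (Σ; ∃; ∃-syntax; _×_; _,_)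
open import Data.Sum using (_⊎_)
open import Relation.Nullary using (¬_; Dec)
open import Relation.Binary.PropositionalEquality using (_≡_; _≢_)
open import Function.Bundles using (_⇔_)
open import Function.Definitions using (Injective)

record Graph : Set₁ where
  field
    n      : ℕ
    Adj    : Fin n → Fin n → Set
    sym    : ∀ {a b} → Adj a b → Adj b a
    irrefl : ∀ {a} → ¬ Adj a a
    dec    : ∀ a b → Dec (Adj a b)

module _ (G : Graph) where
  open Graph G

  V : Set
  V = Fin n

  data Walk : V → V → ℕ → Set where
    here : ∀ {a} → Walk a a zero
    step : ∀ {a b c k} → Adj a b → Walk b c k → Walk a c (suc k)

  Connected : Set
  Connected = ∀ a b → ∃[ k ] Walk a b k

  WalkToEdge : V → V → V → ℕ → Set
  WalkToEdge z x y k = Walk z x k ⊎ Walk z y k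

  DistEdge : V → V → V → ℕ → Set
  DistEdge z x y i = WalkToEdge z x y i × (∀ j → j < i → ¬ WalkToEdge z x y j)

  SameEdge : V → V → V → V → Set
  SameEdge a b c d = (a ≡ c × b ≡ d) ⊎ (a ≡ d × b ≡ c)

  Touch : V → V → V → V → Set
  Touch a b c d = (a ≡ c ⊎ a ≡ d) ⊎ (b ≡ c ⊎ b ≡ d)

record Pattern : Set where
  constructor pat
  field
    m     : ℕ
    edges : List (Fin m × Fin m)

PAdj : (H : Pattern) → Fin (Pattern.m H) → Fin (Pattern.m H) → Set
PAdj H i j = ((i , j) ∈ Pattern.edges H) ⊎ ((j , i) ∈ Pattern.edges H)

InducedCopy : Graph → Pattern → Set
InducedCopy G H =
  Σ (Fin (Pattern.m H) → Fin (Graph.n G)) λ f →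
    Injective _≡_ _≡_ f × (∀ i j → (Graph.Adj G (f i) (f j) ⇔ PAdj H i j))

Free : Graph → Pattern → Set
Free G H = ¬ InducedCopy G H


P8 : Pattern
P8 = pat 8 ((# 0 , # 1) ∷ (# 1 , # 2) ∷ (# 2 , # 3) ∷ (# 3 , # 4) ∷ (# 4 , # 5) ∷ (# 5 , # 6) ∷ (# 6 , # 7) ∷ [])

K4 : Pattern
K4 = pat 4 ((# 0 , # 1) ∷ (# 0 , # 2) ∷ (# 0 , # 3) ∷ (# 1 , # 2) ∷ (# 1 , # 3) ∷ (# 2 , # 3) ∷ [])

Diamond : Pattern
Diamond = pat 4 ((# 0 , # 1) ∷ (# 0 , # 2) ∷ (# 0 , # 3) ∷ (# 1 , # 2) ∷ (# 1 , # 3) ∷ [])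

Butterfly : Pattern
Butterfly = pat 5 ((# 0 , # 1) ∷ (# 0 , # 2) ∷ (# 1 , # 2) ∷ (# 2 , # 3) ∷ (# 2 , # 4) ∷ (# 3 , # 4) ∷ [])

module _ (G : Graph) where
  open Graph G

  record EdgeSet : Set₁ where
    field
      In    : V G → V G → Set
      inSym : ∀ {a b} → In a b → In b a
      inAdj : ∀ {a b} → In a b → Adj a b

  -- dominating induced matching: every edge of G shares a vertex with exactly one edge of M
  IsDIM : EdgeSet → Set
  IsDIM M = ∀ u v → Adj u v →
      (∃[ a ] ∃[ b ] (EdgeSet.In M a b × Touch G u v a b))
    × (∀ a b c d → EdgeSet.In M a b → Touch G u v a b →
                   EdgeSet.In M c d → Touch G u v c d → SameEdge G a b c d)

  AtLeastTwo : EdgeSet → Set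
  AtLeastTwo M = ∃[ a ] ∃[ b ] ∃[ c ] ∃[ d ]
    (EdgeSet.In M a b × EdgeSet.In M c d × ¬ SameEdge G a b c d)

  Covered : EdgeSet → V G → Set
  Covered M v = ∃[ w ] EdgeSet.In M v w

module _ (G : Graph) (x y : Fin (Graph.n G)) where
  open Graph G

  N : ℕ → V G → Set
  N i z = DistEdge G z x y i

  Tone : V G → Set
  Tone t = N 3 t × ∃[ w ] (N 2 w × Adj t w × (∀ w' → N 2 w' → Adj t w' → w' ≡ w))

  T : V G → V G → Set
  T u t = Tone t × Adj t u

  S3 : V G → Set
  S3 t = N 3 t × ¬ Tone t

  I : EdgeSet G → V G → Set
  I M v = ¬ Covered G M v

-- Every edge has an M-covered end, and two adjacent
-- covered vertices are M-partners.  Hence the neighbourhood of a matched vertex u can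
-- only contain edges at its partner u', and two common neighbours of u and u' would be
-- uncovered, non-adjacent, and span a diamond with u u'.  Around xy, every vertex of N₂
-- is covered (its N₁-neighbour is not), so a covered vertex of N₃ has exactly one
-- neighbour in N₂, namely its partner.  This gives (i) and (iv), and colouring N₃ by
-- "covered or not" is proper, which is (iii).
module Submission where

open import Defs
open import Data.Nat using (ℕ; zero; suc; s≤s; z≤n)
open import Data.Nat.Properties using (n<1+n)
open import Data.Fin using (Fin; zero; suc) renaming (_≟_ to _≟ᶠ_)
open import Data.Fin.Properties using (any?)
open import Data.Bool using (Bool)
open import Data.Empty using (⊥-elim)
open import Data.Sum using (_⊎_; inj₁; inj₂; [_,_]′)
open import Data.List.Relation.Unary.Any using (here; there)
open import Data.List.Membership.Propositional using (_∈_)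
open import Data.Product using (Σ; ∃; ∃-syntax; _×_; _,_; proj₁; proj₂)
open import Relation.Nullary using (¬_; Dec; yes; no; does)
open import Relation.Binary.PropositionalEquality using (_≡_; _≢_; refl; sym; trans; subst)
open import Function using (_∘_; id)
open import Function.Bundles using (_⇔_; mk⇔)

module _ (G : Graph) where
  open Graph G renaming (sym to adj-sym)

  adj⇒≢ : ∀ {a b} → Adj a b → a ≢ b
  adj⇒≢ ab refl = irrefl ab

  extend : ∀ {t a x y k} → Adj t a → WalkToEdge G a x y k → WalkToEdge G t x y (suc k)
  extend ta (inj₁ w) = inj₁ (step ta w)
  extend ta (inj₂ w) = inj₂ (step ta w)

  uncons : ∀ {t x y k} → WalkToEdge G t x y (suc k) → ∃[ a ] (Adj t a × WalkToEdge G a x y k)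
  uncons (inj₁ (step ta w)) = _ , ta , inj₁ w
  uncons (inj₂ (step ta w)) = _ , ta , inj₂ w

  diamond-copy : ∀ {a b c d} → Adj a b → Adj a c → Adj a d → Adj b c → Adj b d →
                 ¬ Adj c d → c ≢ d → InducedCopy G Diamond
  diamond-copy {a} {b} {c} {d} ab ac ad bc bd ¬cd c≢d = f , f-injective , λ i j → mk⇔ (to i j) from
    where
    f : Fin 4 → V G
    f zero = a
    f (suc zero) = b
    f (suc (suc zero)) = c
    f (suc (suc (suc zero))) = d

    edge : ∀ {i j} → (i , j) ∈ Pattern.edges Diamond → Adj (f i) (f j)
    edge (here refl) = ab
    edge (there (here refl)) = ac
    edge (there (there (here refl))) = ad
    edge (there (there (there (here refl)))) = bc
    edge (there (there (there (there (here refl))))) = bd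
    edge (there (there (there (there (there ())))))

    from : ∀ {i j} → PAdj Diamond i j → Adj (f i) (f j)
    from (inj₁ e) = edge e
    from (inj₂ e) = adj-sym (edge e)

    to : ∀ i j → Adj (f i) (f j) → PAdj Diamond i j
    to zero zero = ⊥-elim ∘ irrefl
    to zero (suc zero) _ = inj₁ (here refl)
    to zero (suc (suc zero)) _ = inj₁ (there (here refl))
    to zero (suc (suc (suc zero))) _ = inj₁ (there (there (here refl)))
    to (suc zero) zero _ = inj₂ (here refl)
    to (suc zero) (suc zero) = ⊥-elim ∘ irrefl
    to (suc zero) (suc (suc zero)) _ = inj₁ (there (there (there (here refl))))
    to (suc zero) (suc (suc (suc zero))) _ = inj₁ (there (there (there (there (here refl)))))
    to (suc (suc zero)) zero _ = inj₂ (there (here refl))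
    to (suc (suc zero)) (suc zero) _ = inj₂ (there (there (there (here refl))))
    to (suc (suc zero)) (suc (suc zero)) = ⊥-elim ∘ irrefl
    to (suc (suc zero)) (suc (suc (suc zero))) = ⊥-elim ∘ ¬cd
    to (suc (suc (suc zero))) zero _ = inj₂ (there (there (here refl)))
    to (suc (suc (suc zero))) (suc zero) _ = inj₂ (there (there (there (there (here refl)))))
    to (suc (suc (suc zero))) (suc (suc zero)) = ⊥-elim ∘ ¬cd ∘ adj-sym
    to (suc (suc (suc zero))) (suc (suc (suc zero))) = ⊥-elim ∘ irrefl

    f-injective : ∀ {i j} → f i ≡ f j → i ≡ j
    f-injective {zero} {zero} _ = refl
    f-injective {zero} {suc zero} = ⊥-elim ∘ adj⇒≢ ab
    f-injective {zero} {suc (suc zero)} = ⊥-elim ∘ adj⇒≢ ac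
    f-injective {zero} {suc (suc (suc zero))} = ⊥-elim ∘ adj⇒≢ ad
    f-injective {suc zero} {zero} = ⊥-elim ∘ adj⇒≢ ab ∘ sym
    f-injective {suc zero} {suc zero} _ = refl
    f-injective {suc zero} {suc (suc zero)} = ⊥-elim ∘ adj⇒≢ bc
    f-injective {suc zero} {suc (suc (suc zero))} = ⊥-elim ∘ adj⇒≢ bd
    f-injective {suc (suc zero)} {zero} = ⊥-elim ∘ adj⇒≢ ac ∘ sym
    f-injective {suc (suc zero)} {suc zero} = ⊥-elim ∘ adj⇒≢ bc ∘ sym
    f-injective {suc (suc zero)} {suc (suc zero)} _ = refl
    f-injective {suc (suc zero)} {suc (suc (suc zero))} = ⊥-elim ∘ c≢d
    f-injective {suc (suc (suc zero))} {zero} = ⊥-elim ∘ adj⇒≢ ad ∘ sym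
    f-injective {suc (suc (suc zero))} {suc zero} = ⊥-elim ∘ adj⇒≢ bd ∘ sym
    f-injective {suc (suc (suc zero))} {suc (suc zero)} = ⊥-elim ∘ c≢d ∘ sym
    f-injective {suc (suc (suc zero))} {suc (suc (suc zero))} _ = refl

module Matching (G : Graph) (M : EdgeSet G) (dim : IsDIM G M) where
  open Graph G renaming (sym to adj-sym)
  open EdgeSet M

  partners-of-adjacent : ∀ {p p' q q'} → In p p' → In q q' → Adj p q → p ≡ q' × q ≡ p'
  partners-of-adjacent {p} {p'} {q} {q'} pp' qq' pq
    with proj₂ (dim p q pq) p p' q q' pp' (inj₁ (inj₁ refl)) qq' (inj₂ (inj₁ refl))
  ... | inj₁ (p≡q , _) = ⊥-elim (adj⇒≢ G pq p≡q)
  ... | inj₂ (p≡q' , p'≡q) = p≡q' , sym p'≡q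

  covered-neighbour-is-partner : ∀ {u u' p} → In u u' → Adj p u → Covered G M p → p ≡ u'
  covered-neighbour-is-partner uu' pu (_ , pp') = proj₁ (partners-of-adjacent pp' uu' pu)

  edge-has-covered-end : ∀ {p q} → Adj p q → Covered G M p ⊎ Covered G M q
  edge-has-covered-end {p} {q} pq with proj₁ (dim p q pq)
  ... | a , b , ab , inj₁ (inj₁ refl) = inj₁ (b , ab)
  ... | a , b , ab , inj₁ (inj₂ refl) = inj₁ (a , inSym ab)
  ... | a , b , ab , inj₂ (inj₁ refl) = inj₂ (b , ab)
  ... | a , b , ab , inj₂ (inj₂ refl) = inj₂ (a , inSym ab)

  uncovered-independent : ∀ {a b} → ¬ Covered G M a → ¬ Covered G M b → ¬ Adj a b
  uncovered-independent ¬ca ¬cb ab = [ ¬ca , ¬cb ]′ (edge-has-covered-end ab)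

  covered? : ∀ v → Dec (Covered G M v)
  covered? v with any? (dec v)
  ... | no isolated = no λ (w , vw) → isolated (w , inAdj vw)
  ... | yes (w , vw) with proj₁ (dim v w vw)
  ...   | c , d , cd , touch with v ≟ᶠ c | v ≟ᶠ d
  ...     | yes refl | _ = yes (d , cd)
  ...     | no _ | yes refl = yes (c , inSym cd)
  ...     | no v≢c | no v≢d = no λ (z , vz) →
            [ v≢c ∘ proj₁ , v≢d ∘ proj₁ ]′ (proj₂ (dim v w vw) v z c d vz (inj₁ (inj₁ refl)) cd touch)

  common-neighbour-uncovered : ∀ {u u' p} → In u u' → Adj p u → Adj p u' → ¬ Covered G M p
  common-neighbour-uncovered uu' pu pu' = adj⇒≢ G pu' ∘ covered-neighbour-is-partner uu' pu

  edge-meets-partner : ∀ {u u' a b} → In u u' → Adj a u → Adj b u → Adj a b → a ≡ u' ⊎ b ≡ u'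
  edge-meets-partner uu' au bu ab with edge-has-covered-end ab
  ... | inj₁ ca = inj₁ (covered-neighbour-is-partner uu' au ca)
  ... | inj₂ cb = inj₂ (covered-neighbour-is-partner uu' bu cb)

  adjacent-to-two-in-neighbourhood⇒partner : ∀ {u u' v v' t c d} → In u u' → In v v' →
    Adj t u → Adj c v → Adj d v → c ≢ d → Adj t c → Adj t d → t ≡ u'
  adjacent-to-two-in-neighbourhood⇒partner {v = v} {v'} {t} uu' vv' tu cv dv c≢d tc td with covered? t
  ... | yes ct = covered-neighbour-is-partner uu' tu ct
  ... | no ¬ct = ⊥-elim (c≢d (trans (partner-of cv tc) (sym (partner-of dv td))))
    where
    partner-of : ∀ {z} → Adj z v → Adj t z → z ≡ v'
    partner-of zv tz = covered-neighbour-is-partner vv' zv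
      ([ ⊥-elim ∘ ¬ct , id ]′ (edge-has-covered-end tz))

  module _ (diamond-free : Free G Diamond) where

    common-neighbour-unique : ∀ {u u' p q} → In u u' →
      Adj p u → Adj p u' → Adj q u → Adj q u' → p ≡ q
    common-neighbour-unique {u} {u'} {p} {q} uu' pu pu' qu qu' with p ≟ᶠ q
    ... | yes p≡q = p≡q
    ... | no p≢q = ⊥-elim (diamond-free (diamond-copy G (inAdj uu') (adj-sym pu) (adj-sym qu)
                     (adj-sym pu') (adj-sym qu') ¬pq p≢q))
      where
      ¬pq : ¬ Adj p q
      ¬pq = uncovered-independent (common-neighbour-uncovered uu' pu pu')
                                  (common-neighbour-uncovered uu' qu qu')

    neighbourhood-has-one-edge : ∀ {u u' a b c d} → In u u' →
      Adj a u → Adj b u → Adj c u → Adj d u → Adj a b → Adj c d → SameEdge G a b c d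
    neighbourhood-has-one-edge uu' au bu cu du ab cd
      with edge-meets-partner uu' au bu ab | edge-meets-partner uu' cu du cd
    ... | inj₁ refl | inj₁ refl = inj₁ (refl , common-neighbour-unique uu' bu (adj-sym ab) du (adj-sym cd))
    ... | inj₁ refl | inj₂ refl = inj₂ (refl , common-neighbour-unique uu' bu (adj-sym ab) cu cd)
    ... | inj₂ refl | inj₁ refl = inj₂ (common-neighbour-unique uu' au ab du (adj-sym cd) , refl)
    ... | inj₂ refl | inj₂ refl = inj₁ (common-neighbour-unique uu' au ab cu cd , refl)

module Layers (G : Graph) (M : EdgeSet G) (dim : IsDIM G M)
              (x y : Fin (Graph.n G)) (xy : EdgeSet.In M x y) where
  open Graph G renaming (sym to adj-sym)
  open EdgeSet M
  open Matching G M dim public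

  W : V G → ℕ → Set
  W z k = WalkToEdge G z x y k

  N₂-intro : ∀ {z} → W z 2 → ¬ W z 0 → ¬ W z 1 → N G x y 2 z
  N₂-intro w ¬w₀ ¬w₁ = w , λ { zero _ → ¬w₀ ; (suc zero) _ → ¬w₁ ; (suc (suc _)) (s≤s (s≤s ())) }

  N₃-intro : ∀ {z} → W z 3 → ¬ W z 0 → ¬ W z 1 → ¬ W z 2 → N G x y 3 z
  N₃-intro w ¬w₀ ¬w₁ ¬w₂ = w , λ
    { zero _ → ¬w₀ ; (suc zero) _ → ¬w₁ ; (suc (suc zero)) _ → ¬w₂
    ; (suc (suc (suc _))) (s≤s (s≤s (s≤s ()))) }

  N₂∩N₃-empty : ∀ {z} → N G x y 2 z → ¬ N G x y 3 z
  N₂∩N₃-empty (w , _) (_ , shorter) = shorter 2 (n<1+n 2) w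

  N₃-has-N₂-neighbour : ∀ {t} → N G x y 3 t → ∃[ w ] (N G x y 2 w × Adj t w)
  N₃-has-N₂-neighbour (w , shorter) with uncons G w
  ... | a , ta , wa =
    a , N₂-intro wa (shorter 1 (s≤s (s≤s z≤n)) ∘ extend G ta) (shorter 2 (n<1+n 2) ∘ extend G ta) , ta

  covered-near-xy : ∀ {m} → W m 1 → Covered G M m → W m 0
  covered-near-xy (inj₁ (step mx here)) cm with covered-neighbour-is-partner xy mx cm
  ... | refl = inj₂ here
  covered-near-xy (inj₂ (step my here)) cm with covered-neighbour-is-partner (inSym xy) my cm
  ... | refl = inj₁ here

  N₂-covered : ∀ {u} → N G x y 2 u → Covered G M u
  N₂-covered (w , shorter) with uncons G w
  ... | m , um , wm with edge-has-covered-end um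
  ...   | inj₁ cu = cu
  ...   | inj₂ cm = ⊥-elim (shorter 1 (n<1+n 1) (extend G um (covered-near-xy wm cm)))

  partner-in-N₃ : (∀ a b → N G x y 2 a → N G x y 2 b → ¬ Adj a b) →
                  ∀ {u u'} → N G x y 2 u → In u u' → N G x y 3 u'
  partner-in-N₃ N₂-independent {u} {u'} nu@(w , shorter) uu' =
    N₃-intro (extend G (adj-sym (inAdj uu')) w) ¬w₀ ¬w₁ ¬w₂
    where
    ¬w₀ : ¬ W u' 0
    ¬w₀ = shorter 1 (n<1+n 1) ∘ extend G (inAdj uu')
    ¬w₁ : ¬ W u' 1
    ¬w₁ w₁ = ¬w₀ (covered-near-xy w₁ (u , inSym uu'))
    ¬w₂ : ¬ W u' 2
    ¬w₂ w₂ = N₂-independent u u' nu (N₂-intro w₂ ¬w₀ ¬w₁) (inAdj uu')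

  N₂-neighbour-is-partner : ∀ {t t' w} → In t t' → N G x y 2 w → Adj t w → w ≡ t'
  N₂-neighbour-is-partner tt' nw tw = covered-neighbour-is-partner tt' (adj-sym tw) (N₂-covered nw)

  covered-N₃-in-Tone : ∀ {t} → N G x y 3 t → Covered G M t → Tone G x y t
  covered-N₃-in-Tone nt (_ , tt') with N₃-has-N₂-neighbour nt
  ... | w , nw , tw = nt , w , nw , tw , λ w' nw' tw' →
        trans (N₂-neighbour-is-partner tt' nw' tw') (sym (N₂-neighbour-is-partner tt' nw tw))

  T-covered⇔partner : (∀ a b → N G x y 2 a → N G x y 2 b → ¬ Adj a b) →
    ∀ {u u'} → N G x y 2 u → In u u' → ∀ t → (T G x y u t × Covered G M t) ⇔ (t ≡ u')
  T-covered⇔partner N₂-independent {u} {u'} nu uu' t =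
    mk⇔ (λ ((_ , tu) , ct) → covered-neighbour-is-partner uu' tu ct) λ { refl → partner-in-T , u'-covered }
    where
    u'-covered : Covered G M u'
    u'-covered = u , inSym uu'
    partner-in-T : T G x y u u'
    partner-in-T = covered-N₃-in-Tone (partner-in-N₃ N₂-independent nu uu') u'-covered , adj-sym (inAdj uu')

  S₃-uncovered : ∀ {t} → S3 G x y t → ¬ Covered G M t
  S₃-uncovered (nt , ¬tone) = ¬tone ∘ covered-N₃-in-Tone nt

  N₃-covered-independent : ∀ {a b} → N G x y 3 a → N G x y 3 b → Adj a b →
                           Covered G M a → ¬ Covered G M b
  N₃-covered-independent na nb ab (_ , aa') cb with N₃-has-N₂-neighbour na
  ... | w , nw , aw with covered-neighbour-is-partner aa' (adj-sym ab) cb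
  ...   | refl = N₂∩N₃-empty (subst (N G x y 2) (N₂-neighbour-is-partner aa' nw aw) nw) nb

  colour : V G → Bool
  colour v = does (covered? v)

  N₃-colour-proper : ∀ a b → N G x y 3 a → N G x y 3 b → Adj a b → colour a ≢ colour b
  N₃-colour-proper a b na nb ab with covered? a | covered? b
  ... | yes ca | yes cb = λ _ → N₃-covered-independent na nb ab ca cb
  ... | yes _ | no _ = λ ()
  ... | no _ | yes _ = λ ()
  ... | no ¬ca | no ¬cb = λ _ → uncovered-independent ¬ca ¬cb ab

lemma1 : (G : Graph) → Connected G
    → Free G P8 → Free G K4 → Free G Diamond → Free G Butterfly
    → (M : EdgeSet G) → IsDIM G M → AtLeastTwo G M
    → (x y r : Fin (Graph.n G)) → EdgeSet.In M x y
    → Graph.Adj G r x → ¬ Graph.Adj G r y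
    → (∀ a b → N G x y 2 a → N G x y 2 b → ¬ Graph.Adj G a b)
    → (∀ u → N G x y 2 u → ∃[ u' ] (EdgeSet.In M u u' × N G x y 3 u'))
    × (∀ u u' → N G x y 2 u → EdgeSet.In M u u' →
         ∀ t → ((T G x y u t × Covered G M t) ⇔ (t ≡ u')))
    × (∀ u → N G x y 2 u → ∀ a b c d →
         T G x y u a → T G x y u b → T G x y u c → T G x y u d →
         Graph.Adj G a b → Graph.Adj G c d → SameEdge G a b c d)
    × (Σ (Fin (Graph.n G) → Bool) λ col →
         ∀ a b → N G x y 3 a → N G x y 3 b → Graph.Adj G a b → col a ≢ col b)
    × (∀ t → S3 G x y t → I G x y M t)
    × (∀ a b → S3 G x y a → S3 G x y b → ¬ Graph.Adj G a b)
    × (∀ u v u' t c d → N G x y 2 u → N G x y 2 v → u ≢ v → EdgeSet.In M u u' →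
         T G x y u t → T G x y v c → T G x y v d → c ≢ d →
         Graph.Adj G t c → Graph.Adj G t d → t ≡ u')
lemma1 G _ _ _ diamond-free _ M dim _ x y _ xy _ _ N₂-independent =
    (λ u nu → let u' , uu' = N₂-covered nu in u' , uu' , partner-in-N₃ N₂-independent nu uu')
  , (λ u u' nu uu' → T-covered⇔partner N₂-independent nu uu')
  , (λ u nu a b c d ta tb tc td → neighbourhood-has-one-edge diamond-free
      (proj₂ (N₂-covered nu)) (proj₂ ta) (proj₂ tb) (proj₂ tc) (proj₂ td))
  , (colour , N₃-colour-proper)
  , (λ t → S₃-uncovered)
  , (λ a b sa sb → uncovered-independent (S₃-uncovered sa) (S₃-uncovered sb))
  , (λ u v u' t c d _ nv _ uu' tu cv dv → adjacent-to-two-in-neighbourhood⇒partner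
      uu' (proj₂ (N₂-covered nv)) (proj₂ tu) (proj₂ cv) (proj₂ dv))
  where open Layers G M dim x y xy
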